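{- Suppose that $n\geq 4$ is an integer. Then $B_2(C_n)=5$ if and only if $5$ divides $n$.
   Context: $C_n$ is the cycle with vertex set $\mathbb{Z}_n=\{0,1,\dots,n-1\}$, $i$ adjacent to $i\pm1 \pmod n$; the graph distance is $\mathrm{dist}(i,j)=\min(|i-j|,\,n-|i-j|)$. For a set $D$ of positive integers, the distance graph $G(C_n,D)$ has vertex set $\mathbb{Z}_n$, with distinct $i,j$ adjacent iff $\mathrm{dist}(i,j)\in D$; $\chi(C_n,D)$ is its chromatic number. $B_2(C_n)=\max\{\chi(C_n,D): D\subseteq\{1,\dots,\lfloor n/2\rfloor\},\ |D|=2\}$. -}

module Defs where

open import Data.Nat using (ℕ; zero; suc; _≤_; _<_; _⊓_; _∸_; ∣_-_∣; _/_)
open import Data.Fin using (Fin; toℕ)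
open import Data.Product using (Σ; _×_; _,_)
open import Data.Sum using (_⊎_)
open import Relation.Binary.PropositionalEquality using (_≡_; _≢_)
open import Relation.Nullary using (¬_)

cdist : (n : ℕ) → Fin n → Fin n → ℕ
cdist n i j = ∣ toℕ i - toℕ j ∣ ⊓ (n ∸ ∣ toℕ i - toℕ j ∣)

record DistSet2 (n : ℕ) : Set where
  constructor dset
  field
    a b   : ℕ
    a≢b   : a ≢ b
    1≤a   : 1 ≤ a
    1≤b   : 1 ≤ b
    a≤n/2 : a ≤ n / 2
    b≤n/2 : b ≤ n / 2

_∈D_ : ∀ {n} → ℕ → DistSet2 n → Set
d ∈D D = d ≡ DistSet2.a D ⊎ d ≡ DistSet2.b D

Adj : (n : ℕ) → DistSet2 n → Fin n → Fin n → Set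
Adj n D i j = i ≢ j × cdist n i j ∈D D

Colorable : (n : ℕ) → DistSet2 n → ℕ → Set
Colorable n D k = Σ (Fin n → Fin k) λ c → ∀ i j → Adj n D i j → c i ≢ c j

IsChromaticNumber : (n : ℕ) → DistSet2 n → ℕ → Set
IsChromaticNumber n D k = Colorable n D k × (∀ m → m < k → ¬ Colorable n D m)

IsB2 : ℕ → ℕ → Set
IsB2 n k = Σ (DistSet2 n) (λ D → IsChromaticNumber n D k)
         × (∀ (D : DistSet2 n) (m : ℕ) → IsChromaticNumber n D m → m ≤ k)

-- Multiplying by a suitable t and cutting ℤ_n into k arcs of length ⌈n/k⌉ colours
-- G(C_n, {a, b}) properly as soon as t·a and t·b both lie at circular distance at least
-- ⌈n/k⌉ from 0. Such a t exists for k = 5, and for k = 4 unless the problem reduces,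
-- after dividing by gcd(a, n), to the cycle of length 5; so B₂(C_n) ≤ 5, and ≤ 4 when
-- 5 ∤ n. Conversely, for n = 5m the vertices 0, m, 2m, 3m, 4m form a K₅ in G(C_n, {m, 2m}).
module Submission where

open import Defs
open import Data.Empty using (⊥-elim)
open import Data.Fin using (Fin; toℕ; fromℕ<)
open import Data.Fin.Properties using (toℕ<n; toℕ-fromℕ<; pigeonhole)
open import Data.Nat
open import Data.Nat.DivMod
open import Data.Nat.Divisibility
open import Data.Nat.GCD
open import Data.Nat.Properties
open import Data.Nat.Tactic.RingSolver using (solve-∀)
open import Data.Product using (∃; _×_; _,_; proj₁; proj₂)
open import Data.Sum using (_⊎_; inj₁; inj₂)
open import Function.Bundles using (_⇔_; mk⇔)
open import Relation.Nullary using (¬_; Dec; yes; no)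
open import Relation.Nullary.Decidable using (decidable-stable)
open import Relation.Binary.PropositionalEquality

m+n∸o<n : ∀ m n o → m < o → o ≤ m + n → m + n ∸ o < n
m+n∸o<n m zero o m<o o≤m+0 = ⊥-elim (<⇒≱ m<o (subst (o ≤_) (+-identityʳ m) o≤m+0))
m+n∸o<n m (suc n) o m<o _ = m<n+o⇒m∸n<o (m + suc n) o (+-monoˡ-< (suc n) m<o)

n≢0⇒n≢1⇒2≤n : ∀ {n} → n ≢ 0 → n ≢ 1 → 2 ≤ n
n≢0⇒n≢1⇒2≤n {0} n≢0 _ = ⊥-elim (n≢0 refl)
n≢0⇒n≢1⇒2≤n {1} _ n≢1 = ⊥-elim (n≢1 refl)
n≢0⇒n≢1⇒2≤n {suc (suc n)} _ _ = s≤s (s≤s z≤n)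

2*n≡n+n : ∀ n → 2 * n ≡ n + n
2*n≡n+n n = cong (n +_) (+-identityʳ n)

2*m≤n⇒m<n : ∀ {m n} → 1 ≤ m → 2 * m ≤ n → m < n
2*m≤n⇒m<n {m} {n} 1≤m 2m≤n = ≤-trans (+-monoˡ-≤ m 1≤m) (subst (_≤ n) (2*n≡n+n m) 2m≤n)

m+n≡o⇒o<2*n⇒2*m≤o : ∀ m n {o} → m + n ≡ o → o < 2 * n → 2 * m ≤ o
m+n≡o⇒o<2*n⇒2*m≤o m n {o} m+n≡o o<2n =
  subst (_≤ o) (sym (2*n≡n+n m)) (<⇒≤ (subst (m + m <_) m+n≡o (+-monoʳ-< m m<n)))
  where
    m<n : m < n
    m<n = +-cancelʳ-< n m n (subst (_< n + n) (sym m+n≡o) (subst (o <_) (2*n≡n+n n) o<2n))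

2*m≤2*n+1⇒m≤n : ∀ m n → 2 * m ≤ 2 * n + 1 → m ≤ n
2*m≤2*n+1⇒m≤n m n le with m ≤? n
... | yes m≤n = m≤n
... | no m≰n = ⊥-elim (<⇒≱ (≤-reflexive (suc[2*n+1]≡2*[1+n] n)) (≤-trans (*-monoʳ-≤ 2 (≰⇒> m≰n)) le))
  where
    suc[2*n+1]≡2*[1+n] : ∀ n → suc (2 * n + 1) ≡ 2 * suc n
    suc[2*n+1]≡2*[1+n] = solve-∀

m≤n/2⇒2*m≤n : ∀ m n → m ≤ n / 2 → 2 * m ≤ n
m≤n/2⇒2*m≤n m n le = ≤-trans (*-monoʳ-≤ 2 le) (≤-trans (≤-reflexive (*-comm 2 (n / 2))) (m/n*n≤m n 2))

2*m≤n⇒m≤n/2 : ∀ m n → 2 * m ≤ n → m ≤ n / 2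
2*m≤n⇒m≤n/2 m n le = subst (_≤ n / 2) (m*n/n≡m m 2) (/-monoˡ-≤ 2 (subst (_≤ n) (*-comm 2 m) le))

distinct-halves⇒4≤n : ∀ {a b n} → 1 ≤ a → 1 ≤ b → a ≢ b → 2 * a ≤ n → 2 * b ≤ n → 4 ≤ n
distinct-halves⇒4≤n {1} {1} _ _ a≢b _ _ = ⊥-elim (a≢b refl)
distinct-halves⇒4≤n {suc (suc a)} _ _ _ 2a≤n _ = ≤-trans (*-monoʳ-≤ 2 (s≤s (s≤s (z≤n {a})))) 2a≤n
distinct-halves⇒4≤n {1} {suc (suc b)} _ _ _ _ 2b≤n = ≤-trans (*-monoʳ-≤ 2 (s≤s (s≤s (z≤n {b})))) 2b≤n

module _ (n : ℕ) .{{_ : NonZero n}} where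

  [m+o]%n≡[m%n+o]%n : ∀ m o → (m + o) % n ≡ (m % n + o) % n
  [m+o]%n≡[m%n+o]%n m o = begin
    (m + o) % n              ≡⟨ %-distribˡ-+ m o n ⟩
    (m % n + o % n) % n      ≡⟨ cong (λ z → (z + o % n) % n) (sym (m%n%n≡m%n m n)) ⟩
    (m % n % n + o % n) % n  ≡⟨ sym (%-distribˡ-+ (m % n) o n) ⟩
    (m % n + o) % n          ∎
    where open ≡-Reasoning

  %-+-cong : ∀ {a a′ b b′} → a % n ≡ a′ % n → b % n ≡ b′ % n → (a + b) % n ≡ (a′ + b′) % n
  %-+-cong {a} {a′} {b} {b′} a≡a′ b≡b′ = begin
    (a + b) % n            ≡⟨ %-distribˡ-+ a b n ⟩
    (a % n + b % n) % n    ≡⟨ cong₂ (λ x y → (x + y) % n) a≡a′ b≡b′ ⟩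
    (a′ % n + b′ % n) % n  ≡⟨ sym (%-distribˡ-+ a′ b′ n) ⟩
    (a′ + b′) % n          ∎
    where open ≡-Reasoning

  %-*-cong : ∀ {a a′ b b′} → a % n ≡ a′ % n → b % n ≡ b′ % n → (a * b) % n ≡ (a′ * b′) % n
  %-*-cong {a} {a′} {b} {b′} a≡a′ b≡b′ = begin
    (a * b) % n                ≡⟨ %-distribˡ-* a b n ⟩
    (a % n * (b % n)) % n      ≡⟨ cong₂ (λ x y → (x * y) % n) a≡a′ b≡b′ ⟩
    (a′ % n * (b′ % n)) % n    ≡⟨ sym (%-distribˡ-* a′ b′ n) ⟩
    (a′ * b′) % n              ∎
    where open ≡-Reasoning

  %-*-congʳ : ∀ a {b b′} → b % n ≡ b′ % n → (a * b) % n ≡ (a * b′) % n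
  %-*-congʳ a = %-*-cong {a} {a} refl

  m%n≡0⇒m≡n : ∀ {m} → 1 ≤ m → m ≤ n → m % n ≡ 0 → m ≡ n
  m%n≡0⇒m≡n {m} 1≤m m≤n m%n≡0 with m <? n
  ... | yes m<n = ⊥-elim (<⇒≱ 1≤m (≤-reflexive (trans (sym (m<n⇒m%n≡m m<n)) m%n≡0)))
  ... | no m≮n = ≤-antisym m≤n (≮⇒≥ m≮n)

  %-injective : ∀ {m o} → m < n → o < n → m % n ≡ o % n → m ≡ o
  %-injective m<n o<n eq = trans (sym (m<n⇒m%n≡m m<n)) (trans eq (m<n⇒m%n≡m o<n))

  Bézout⇒multiplier : ∀ {d} s → Bézout.Identity d s n → ∃ λ u → (u * s) % n ≡ d % n
  Bézout⇒multiplier {d} s (Bézout.+- x y d+yn≡xs) = x , (begin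
    (x * s) % n      ≡⟨ cong (_% n) (sym d+yn≡xs) ⟩
    (d + y * n) % n  ≡⟨ [m+kn]%n≡m%n d y n ⟩
    d % n            ∎)
    where open ≡-Reasoning
  -- Here x * pred n acts as −x modulo n.
  Bézout⇒multiplier {d} s (Bézout.-+ x y d+xs≡yn) = x * pred n , (begin
    (x * pred n * s) % n               ≡⟨ sym ([m+kn]%n≡m%n (x * pred n * s) y n) ⟩
    (x * pred n * s + y * n) % n       ≡⟨ cong (λ z → (x * pred n * s + z) % n) (sym d+xs≡yn) ⟩
    (x * pred n * s + (d + x * s)) % n ≡⟨ cong (_% n) (regroup x (pred n) s d) ⟩
    (d + (x * s) * suc (pred n)) % n   ≡⟨ cong (λ z → (d + (x * s) * z) % n) (suc-pred n) ⟩
    (d + (x * s) * n) % n              ≡⟨ [m+kn]%n≡m%n d (x * s) n ⟩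
    d % n                              ∎)
    where
      open ≡-Reasoning
      regroup : ∀ x p s d → x * p * s + (d + x * s) ≡ d + (x * s) * suc p
      regroup = solve-∀

  gcd-multiplier : ∀ s → ∃ λ u → (u * s) % n ≡ gcd s n % n
  gcd-multiplier s = Bézout⇒multiplier s (Bézout.identity (gcd-GCD s n))

-- x is at circular distance at least q from 0 in ℤ_n.
Far : (n : ℕ) .{{_ : NonZero n}} → ℕ → ℕ → Set
Far n q x = q ≤ x % n × q + x % n ≤ n

Far-cong : ∀ n .{{_ : NonZero n}} {q x y} → x % n ≡ y % n → Far n q x → Far n q y
Far-cong n {q} x≡y = subst (λ r → q ≤ r × q + r ≤ n) x≡y

Far-neg : ∀ n .{{_ : NonZero n}} {q} x y → (x + y) % n ≡ 0 → Far n (suc q) x → Far n (suc q) y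
Far-neg n {q} x y x+y≡0 (q≤x′ , q+x′≤n) =
  +-cancelˡ-≤ x′ (suc q) y′ (subst₂ _≤_ (+-comm (suc q) x′) (sym x′+y′≡n) q+x′≤n) ,
  subst (suc q + y′ ≤_) x′+y′≡n (+-monoˡ-≤ y′ q≤x′)
  where
    x′ = x % n
    y′ = y % n
    x′+y′≡0 : (x′ + y′) % n ≡ 0
    x′+y′≡0 = trans (sym (%-distribˡ-+ x y n)) x+y≡0
    x′+y′≤n : x′ + y′ ≤ n
    x′+y′≤n with x′ + y′ <? n
    ... | yes lt = <⇒≤ lt
    ... | no ≮ = m∸n≡0⇒m≤n (begin
      x′ + y′ ∸ n            ≡⟨ sym (m<n⇒m%n≡m wrapped<n) ⟩
      (x′ + y′ ∸ n) % n      ≡⟨ m≤n⇒[n∸m]%m≡n%m (≮⇒≥ ≮) ⟩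
      (x′ + y′) % n          ≡⟨ x′+y′≡0 ⟩
      0                      ∎)
      where
        open ≡-Reasoning
        wrapped<n : x′ + y′ ∸ n < n
        wrapped<n = <-trans (m+n∸o<n x′ y′ n (m%n<n x n) (≮⇒≥ ≮)) (m%n<n y n)
    x′+y′≡n : x′ + y′ ≡ n
    x′+y′≡n = m%n≡0⇒m≡n n (≤-trans (s≤s z≤n) (≤-trans q≤x′ (m≤m+n x′ y′))) x′+y′≤n x′+y′≡0

Far-*ʳ : ∀ {n n₁ d q q₁} .{{_ : NonZero n}} .{{_ : NonZero n₁}} →
         n ≡ n₁ * d → q ≤ d * q₁ → ∀ x → Far n₁ q₁ x → Far n q (x * d)
Far-*ʳ {n} {n₁} {d} {q} {q₁} n≡n₁d q≤dq₁ x (q₁≤x′ , q₁+x′≤n₁) =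
  subst (λ r → q ≤ r × q + r ≤ n) (sym [xd]%n≡x′d) (q≤x′d , q+x′d≤n)
  where
    instance
      n₁d≢0 : NonZero (n₁ * d)
      n₁d≢0 = ≢-nonZero (λ n₁d≡0 → ≢-nonZero⁻¹ n (trans n≡n₁d n₁d≡0))
    x′ = x % n₁
    [xd]%n≡x′d : (x * d) % n ≡ x′ * d
    [xd]%n≡x′d = trans (%-congʳ n≡n₁d) (sym (m%n*o≡m*o%[n*o] x n₁ d))
    q≤x′d : q ≤ x′ * d
    q≤x′d = ≤-trans q≤dq₁ (≤-trans (≤-reflexive (*-comm d q₁)) (*-monoˡ-≤ d q₁≤x′))
    q+x′d≤n : q + x′ * d ≤ n
    q+x′d≤n = begin
      q + x′ * d        ≤⟨ +-monoˡ-≤ (x′ * d) q≤dq₁ ⟩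
      d * q₁ + x′ * d   ≡⟨ cong (_+ x′ * d) (*-comm d q₁) ⟩
      q₁ * d + x′ * d   ≡⟨ sym (*-distribʳ-+ d q₁ x′) ⟩
      (q₁ + x′) * d     ≤⟨ *-monoˡ-≤ d q₁+x′≤n₁ ⟩
      n₁ * d            ≡⟨ sym n≡n₁d ⟩
      n                 ∎
      where open ≤-Reasoning

-- Shifting by q₀ turns the residues that are not Far n (suc q₀) into the initial
-- segment [0, q + q₀) of ℤ_n, so a walk can only leave it by landing on a far residue.
module Walk (n : ℕ) .{{_ : NonZero n}} (q₀ : ℕ) where

  q : ℕ
  q = suc q₀

  shift : ℕ → ℕ
  shift x = (x + q₀) % n

  FarShifted : ℕ → Set
  FarShifted x = q + q₀ ≤ shift x

  FarShifted⇒Far : ∀ x → FarShifted x → Far n q x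
  FarShifted⇒Far x far with x % n + q₀ <? n
  ... | yes x′+q₀<n =
    +-cancelʳ-≤ q₀ q (x % n) (subst (q + q₀ ≤_) shift≡x′+q₀ far) ,
    subst (_≤ n) (cong suc (+-comm (x % n) q₀)) x′+q₀<n
    where
      shift≡x′+q₀ : shift x ≡ x % n + q₀
      shift≡x′+q₀ = trans ([m+o]%n≡[m%n+o]%n n x q₀) (m<n⇒m%n≡m x′+q₀<n)
  ... | no x′+q₀≮n = ⊥-elim (<⇒≱ shift<q+q₀ far)
    where
      n≤x′+q₀ = ≮⇒≥ x′+q₀≮n
      shift<q+q₀ : shift x < q + q₀
      shift<q+q₀ = begin-strict
        shift x                ≡⟨ [m+o]%n≡[m%n+o]%n n x q₀ ⟩
        (x % n + q₀) % n       ≡⟨ sym (m≤n⇒[n∸m]%m≡n%m n≤x′+q₀) ⟩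
        (x % n + q₀ ∸ n) % n   ≤⟨ m%n≤m _ n ⟩
        x % n + q₀ ∸ n         <⟨ m+n∸o<n (x % n) q₀ n (m%n<n x n) n≤x′+q₀ ⟩
        q₀                     ≤⟨ m≤n+m q₀ q ⟩
        q + q₀                 ∎
        where open ≤-Reasoning

  EscapesWithin : ℕ → ℕ → ℕ → Set
  EscapesWithin x m N = ∃ λ j → j ≤ N × FarShifted (x + j * m)

  StaysNear : ℕ → ℕ → ℕ → Set
  StaysNear x m N = shift (x + N * m) ≡ shift x + N * m × shift x + N * m < q + q₀

  -- While the walk stays near 0, a step of size m cannot wrap around ℤ_n.
  escape-or-stay : ∀ x m → m + (q + q₀) ≤ n → ∀ N → EscapesWithin x m N ⊎ StaysNear x m N
  escape-or-stay x m _ zero with q + q₀ ≤? shift (x + 0)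
  ... | yes far = inj₁ (0 , z≤n , far)
  ... | no near = inj₂ (shift[x+0]≡shift[x]+0 , subst (_< q + q₀) shift[x+0]≡shift[x]+0 (≰⇒> near))
    where
      shift[x+0]≡shift[x]+0 : shift (x + 0) ≡ shift x + 0
      shift[x+0]≡shift[x]+0 = trans (cong shift (+-identityʳ x)) (sym (+-identityʳ (shift x)))
  escape-or-stay x m m+w≤n (suc N) with escape-or-stay x m m+w≤n N
  ... | inj₁ (j , j≤N , far) = inj₁ (j , m≤n⇒m≤1+n j≤N , far)
  ... | inj₂ (shift≡ , near) with q + q₀ ≤? shift (x + suc N * m)
  ...   | yes far = inj₁ (suc N , ≤-refl , far)
  ...   | no ¬far = inj₂ (shift≡′ , subst (_< q + q₀) shift≡′ (≰⇒> ¬far))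
    where
      open ≡-Reasoning
      no-wrap : shift x + N * m + m < n
      no-wrap = ≤-trans (+-monoˡ-< m near) (subst (_≤ n) (+-comm m (q + q₀)) m+w≤n)
      step : ∀ x N m q₀ → x + suc N * m + q₀ ≡ (x + N * m + q₀) + m
      step = solve-∀
      step′ : ∀ r N m → r + N * m + m ≡ r + suc N * m
      step′ = solve-∀
      shift≡′ : shift (x + suc N * m) ≡ shift x + suc N * m
      shift≡′ = begin
        (x + suc N * m + q₀) % n          ≡⟨ cong (_% n) (step x N m q₀) ⟩
        ((x + N * m + q₀) + m) % n        ≡⟨ [m+o]%n≡[m%n+o]%n n (x + N * m + q₀) m ⟩
        (shift (x + N * m) + m) % n       ≡⟨ cong (λ z → (z + m) % n) shift≡ ⟩
        (shift x + N * m + m) % n         ≡⟨ m<n⇒m%n≡m no-wrap ⟩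
        shift x + N * m + m               ≡⟨ step′ (shift x) N m ⟩
        shift x + suc N * m               ∎

  far-on-walk : ∀ x m → 1 ≤ m → m + (q + q₀) ≤ n → ∃ λ j → Far n q (x + j * m)
  far-on-walk x m 1≤m m+w≤n with escape-or-stay x m m+w≤n n
  ... | inj₁ (j , _ , far) = j , FarShifted⇒Far _ far
  ... | inj₂ (_ , near) = ⊥-elim (<-irrefl refl (begin-strict
        n                 ≡⟨ sym (*-identityʳ n) ⟩
        n * 1             ≤⟨ *-monoʳ-≤ n 1≤m ⟩
        n * m             ≤⟨ m≤n+m (n * m) (shift x) ⟩
        shift x + n * m   <⟨ near ⟩
        q + q₀            ≤⟨ m≤n+m (q + q₀) m ⟩
        m + (q + q₀)      ≤⟨ m+w≤n ⟩
        n                 ∎))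
    where open ≤-Reasoning

  far-on-multiples : ∀ x s h → 1 ≤ h → h + (q + q₀) ≤ n → (∃ λ u → (u * s) % n ≡ h % n) →
                     ∃ λ k → Far n q (x + k * s)
  far-on-multiples x s h 1≤h h+w≤n (u , us≡h) with far-on-walk x h 1≤h h+w≤n
  ... | j , far = u * j , Far-cong n (%-+-cong n {x} refl jh≡ujs) far
    where
      open ≡-Reasoning
      reassoc : ∀ j u s → j * (u * s) ≡ u * j * s
      reassoc = solve-∀
      jh≡ujs : (j * h) % n ≡ (u * j * s) % n
      jh≡ujs = begin
        (j * h) % n         ≡⟨ %-*-congʳ n j (sym us≡h) ⟩
        (j * (u * s)) % n   ≡⟨ cong (_% n) (reassoc j u s) ⟩
        (u * j * s) % n     ∎

  -- s runs through the far residues q, …, n ∸ q while s * c advances by c ≥ 2; the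
  -- near window of width 2q − 1 cannot absorb 2(n ∸ 2q) because 6q ≤ 2n + 1.
  far-with-multiple : ∀ c → 2 ≤ c → c + (q + q₀) ≤ n → 6 * q ≤ 2 * n + 1 →
                      ∃ λ s → Far n q s × Far n q (s * c)
  far-with-multiple c 2≤c c+w≤n 6q≤2n+1 = conclude (escape-or-stay (q * c) c c+w≤n N)
    where
      2q≤n : q + q ≤ n
      2q≤n = ≤-trans (≤-reflexive (+-suc q q₀))
               (≤-trans (n≤1+n _) (≤-trans (+-monoˡ-≤ (q + q₀) 2≤c) c+w≤n))
      N = n ∸ (q + q)
      distrib : ∀ q j c → q * c + j * c ≡ (q + j) * c
      distrib = solve-∀
      conclude : EscapesWithin (q * c) c N ⊎ StaysNear (q * c) c N → ∃ λ s → Far n q s × Far n q (s * c)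
      conclude (inj₁ (j , j≤N , far)) =
        q + j , far-q+j , subst (Far n q) (distrib q j c) (FarShifted⇒Far _ far)
        where
          q+q+j≤n : q + (q + j) ≤ n
          q+q+j≤n = begin
            q + (q + j)              ≡⟨ sym (+-assoc q q j) ⟩
            (q + q) + j              ≤⟨ +-monoʳ-≤ (q + q) j≤N ⟩
            (q + q) + N              ≡⟨ m+[n∸m]≡n 2q≤n ⟩
            n                        ∎
            where open ≤-Reasoning
          far-q+j : Far n q (q + j)
          far-q+j rewrite m<n⇒m%n≡m (≤-trans (+-monoˡ-≤ (q + j) (s≤s z≤n)) q+q+j≤n) =
            m≤m+n q j , q+q+j≤n
      conclude (inj₂ (_ , near)) = ⊥-elim (<-irrefl refl (begin-strict
        6 * q                                   ≤⟨ 6q≤2n+1 ⟩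
        2 * n + 1                               ≡⟨ cong (λ z → 2 * z + 1) (sym (m∸n+n≡m 2q≤n)) ⟩
        2 * (N + (q + q)) + 1                   ≡⟨ expand N q ⟩
        N * 2 + (4 * q + 1)                     ≤⟨ +-monoˡ-≤ (4 * q + 1) (*-monoʳ-≤ N 2≤c) ⟩
        N * c + (4 * q + 1)                     ≤⟨ +-monoˡ-≤ (4 * q + 1) (m≤n+m (N * c) (shift (q * c))) ⟩
        shift (q * c) + N * c + (4 * q + 1)     <⟨ +-monoˡ-< (4 * q + 1) near ⟩
        q + q₀ + (4 * q + 1)                    ≡⟨ collect q₀ ⟩
        6 * q                                   ∎))
        where
          open ≤-Reasoning
          expand : ∀ N q → 2 * (N + (q + q)) + 1 ≡ N * 2 + (4 * q + 1)
          expand = solve-∀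
          collect : ∀ q₀ → suc q₀ + q₀ + (4 * suc q₀ + 1) ≡ 6 * suc q₀
          collect = solve-∀

-- c ≡ ±u·b is the ratio b/a in ℤ_n up to sign; it avoids 0 and ±1 because b ≢ 0, ±a.
ratio-representative : ∀ n .{{_ : NonZero n}} q a b u → 1 ≤ a → 1 ≤ b → a ≢ b →
  2 * a ≤ n → 2 * b ≤ n → (u * a) % n ≡ 1 % n →
  ∃ λ c → 2 ≤ c × 2 * c ≤ n × (∀ s → Far n (suc q) (s * c) → Far n (suc q) (s * (u * b)))
ratio-representative n q a b u 1≤a 1≤b a≢b 2a≤n 2b≤n ua≡1 = choose (2 * c₀ ≤? n)
  where
    open ≡-Reasoning
    c₀ = (u * b) % n
    c₀<n = m%n<n (u * b) n
    a<n = 2*m≤n⇒m<n 1≤a 2a≤n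
    b<n = 2*m≤n⇒m<n 1≤b 2b≤n
    reassoc : ∀ a u b → a * (u * b) ≡ u * a * b
    reassoc = solve-∀
    ac₀≡b : (a * c₀) % n ≡ b % n
    ac₀≡b = begin
      (a * c₀) % n       ≡⟨ %-*-congʳ n a (m%n%n≡m%n (u * b) n) ⟩
      (a * (u * b)) % n  ≡⟨ cong (_% n) (reassoc a u b) ⟩
      (u * a * b) % n    ≡⟨ %-*-cong n ua≡1 refl ⟩
      (1 * b) % n        ≡⟨ cong (_% n) (*-identityˡ b) ⟩
      b % n              ∎
    c₀≢0 : c₀ ≢ 0
    c₀≢0 c₀≡0 = <⇒≢ 1≤b (sym (%-injective n b<n (>-nonZero⁻¹ n) (begin
      b % n         ≡⟨ sym ac₀≡b ⟩
      (a * c₀) % n  ≡⟨ cong (λ z → (a * z) % n) c₀≡0 ⟩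
      (a * 0) % n   ≡⟨ cong (_% n) (*-zeroʳ a) ⟩
      0 % n         ∎)))
    c₀≢1 : c₀ ≢ 1
    c₀≢1 c₀≡1 = a≢b (%-injective n a<n b<n (begin
      a % n         ≡⟨ cong (_% n) (*-identityʳ a) ⟨
      (a * 1) % n   ≡⟨ cong (λ z → (a * z) % n) c₀≡1 ⟨
      (a * c₀) % n  ≡⟨ ac₀≡b ⟩
      b % n         ∎))
    n∸c₀≢0 : n ∸ c₀ ≢ 0
    n∸c₀≢0 n∸c₀≡0 = <⇒≱ c₀<n (m∸n≡0⇒m≤n n∸c₀≡0)
    n∸c₀+c₀≡n : n ∸ c₀ + c₀ ≡ n
    n∸c₀+c₀≡n = m∸n+n≡m (<⇒≤ c₀<n)
    n∸c₀≢1 : n ∸ c₀ ≢ 1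
    n∸c₀≢1 n∸c₀≡1 = a≢b (≤-antisym (halve a b 2a≤a+b) (halve b a (subst (2 * b ≤_) (+-comm a b) 2b≤a+b)))
      where
        expand : ∀ a c → a + a * c ≡ a * (c + 1)
        expand = solve-∀
        c₀+1≡n : c₀ + 1 ≡ n
        c₀+1≡n = trans (+-comm c₀ 1) (trans (cong (_+ c₀) (sym n∸c₀≡1)) n∸c₀+c₀≡n)
        a+b≡0 : (a + b) % n ≡ 0
        a+b≡0 = begin
          (a + b) % n             ≡⟨ %-+-cong n {a} refl (sym ac₀≡b) ⟩
          (a + a * c₀) % n        ≡⟨ cong (_% n) (expand a c₀) ⟩
          (a * (c₀ + 1)) % n      ≡⟨ cong (λ z → (a * z) % n) c₀+1≡n ⟩
          (a * n) % n             ≡⟨ m*n%n≡0 a n ⟩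
          0                       ∎
        a+b≤n : a + b ≤ n
        a+b≤n = *-cancelˡ-≤ 2 (subst₂ _≤_ (sym (*-distribˡ-+ 2 a b)) (sym (2*n≡n+n n)) (+-mono-≤ 2a≤n 2b≤n))
        a+b≡n : a + b ≡ n
        a+b≡n = m%n≡0⇒m≡n n (≤-trans 1≤a (m≤m+n a b)) a+b≤n a+b≡0
        2a≤a+b = subst (2 * a ≤_) (sym a+b≡n) 2a≤n
        2b≤a+b = subst (2 * b ≤_) (sym a+b≡n) 2b≤n
        halve : ∀ x y → 2 * x ≤ x + y → x ≤ y
        halve x y le = +-cancelˡ-≤ x x y (subst (_≤ x + y) (2*n≡n+n x) le)
    choose : Dec (2 * c₀ ≤ n) →
      ∃ λ c → 2 ≤ c × 2 * c ≤ n × (∀ s → Far n (suc q) (s * c) → Far n (suc q) (s * (u * b)))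
    choose (yes 2c₀≤n) = c₀ , n≢0⇒n≢1⇒2≤n c₀≢0 c₀≢1 , 2c₀≤n ,
      λ s → Far-cong n (%-*-congʳ n s (m%n%n≡m%n (u * b) n))
    choose (no 2c₀≰n) = n ∸ c₀ , n≢0⇒n≢1⇒2≤n n∸c₀≢0 n∸c₀≢1 ,
      m+n≡o⇒o<2*n⇒2*m≤o (n ∸ c₀) c₀ n∸c₀+c₀≡n (≰⇒> 2c₀≰n) , λ s → Far-neg n (s * (n ∸ c₀)) (s * (u * b)) (s[n∸c₀]+sub≡0 s)
      where
        s[n∸c₀]+sub≡0 : ∀ s → (s * (n ∸ c₀) + s * (u * b)) % n ≡ 0
        s[n∸c₀]+sub≡0 s = begin
          (s * (n ∸ c₀) + s * (u * b)) % n   ≡⟨ %-+-cong n {s * (n ∸ c₀)} refl (%-*-congʳ n s (sym (m%n%n≡m%n (u * b) n))) ⟩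
          (s * (n ∸ c₀) + s * c₀) % n        ≡⟨ cong (_% n) (sym (*-distribˡ-+ s (n ∸ c₀) c₀)) ⟩
          (s * (n ∸ c₀ + c₀)) % n            ≡⟨ cong (λ z → (s * z) % n) n∸c₀+c₀≡n ⟩
          (s * n) % n                        ≡⟨ m*n%n≡0 s n ⟩
          0                                  ∎

module Arcs (k : ℕ) .{{_ : NonZero k}} (4≤k : 4 ≤ k) where

  q₀ : ℕ → ℕ
  q₀ n = pred n / k

  -- The ceiling of n / k for n ≥ 1, but 1 at n = 0.
  ⌈_/k⌉ : ℕ → ℕ
  ⌈ n /k⌉ = suc (q₀ n)

  n≤⌈n/k⌉*k : ∀ n → n ≤ ⌈ n /k⌉ * k
  n≤⌈n/k⌉*k zero = z≤n
  n≤⌈n/k⌉*k (suc n) = begin-strict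
    n                     ≡⟨ m≡m%n+[m/n]*n n k ⟩
    n % k + (n / k) * k   <⟨ +-monoˡ-< ((n / k) * k) (m%n<n n k) ⟩
    k + (n / k) * k       ∎
    where open ≤-Reasoning

  n≤m*k⇒⌈n/k⌉≤m : ∀ n m → 1 ≤ n → n ≤ m * k → ⌈ n /k⌉ ≤ m
  n≤m*k⇒⌈n/k⌉≤m (suc n) m _ le = *-cancelʳ-< k (n / k) m (≤-trans (s≤s (m/n*n≤m n k)) le)

  ⌈m*d/k⌉≤d*⌈m/k⌉ : ∀ m d → 1 ≤ m → 1 ≤ d → ⌈ m * d /k⌉ ≤ d * ⌈ m /k⌉
  ⌈m*d/k⌉≤d*⌈m/k⌉ m d 1≤m 1≤d = n≤m*k⇒⌈n/k⌉≤m (m * d) (d * ⌈ m /k⌉) (*-mono-≤ 1≤m 1≤d)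
    (≤-trans (*-monoˡ-≤ d (n≤⌈n/k⌉*k m)) (≤-reflexive (reorder ⌈ m /k⌉ k d)))
    where
      reorder : ∀ a k d → a * k * d ≡ d * a * k
      reorder = solve-∀

  2*m≤n⇒m+⌈n/k⌉+q₀≤n : ∀ n m → 1 ≤ n → 2 * m ≤ n → m + (⌈ n /k⌉ + q₀ n) ≤ n
  2*m≤n⇒m+⌈n/k⌉+q₀≤n (suc n) m _ 2m≤1+n =
    ≤-trans (≤-reflexive (regroup m g)) (s≤s (2*m≤2*n+1⇒m≤n (m + 2 * g) n (begin
      2 * (m + 2 * g)   ≡⟨ expand m g ⟩
      2 * m + 4 * g     ≤⟨ +-monoʳ-≤ (2 * m) 4g≤n ⟩
      2 * m + n         ≤⟨ +-monoˡ-≤ n 2m≤1+n ⟩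
      suc n + n         ≡⟨ collect n ⟩
      2 * n + 1         ∎)))
    where
      open ≤-Reasoning
      g = n / k
      4g≤n : 4 * g ≤ n
      4g≤n = ≤-trans (*-monoˡ-≤ g 4≤k) (≤-trans (≤-reflexive (*-comm k g)) (m/n*n≤m n k))
      regroup : ∀ m g → m + (suc g + g) ≡ suc (m + 2 * g)
      regroup = solve-∀
      expand : ∀ m g → 2 * (m + 2 * g) ≡ 2 * m + 4 * g
      expand = solve-∀
      collect : ∀ n → suc n + n ≡ 2 * n + 1
      collect = solve-∀

6*⌈n/5⌉≤2*n+1 : ∀ n → 4 ≤ n → 6 * suc (pred n / 5) ≤ 2 * n + 1
6*⌈n/5⌉≤2*n+1 1 (s≤s ())
6*⌈n/5⌉≤2*n+1 2 (s≤s (s≤s ()))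
6*⌈n/5⌉≤2*n+1 3 (s≤s (s≤s (s≤s ())))
6*⌈n/5⌉≤2*n+1 4 _ = s≤s (s≤s (s≤s (s≤s (s≤s (s≤s z≤n)))))
6*⌈n/5⌉≤2*n+1 (suc (suc (suc (suc (suc n))))) _ = *-cancelˡ-≤ 5 (begin
    5 * (6 * suc g)       ≡⟨ expand g ⟩
    6 * (g * 5) + 30      ≤⟨ +-monoˡ-≤ 30 (*-monoʳ-≤ 6 (m/n*n≤m (4 + n) 5)) ⟩
    6 * (4 + n) + 30      ≡⟨ collect n ⟩
    6 * n + 54            ≤⟨ +-mono-≤ (*-monoˡ-≤ n {6} {10} (s≤s (s≤s (s≤s (s≤s (s≤s (s≤s z≤n))))))) (n≤1+n 54) ⟩
    10 * n + 55           ≡⟨ factor n ⟩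
    5 * (2 * (5 + n) + 1) ∎)
  where
    open ≤-Reasoning
    g = (4 + n) / 5
    expand : ∀ g → 5 * (6 * suc g) ≡ 6 * (g * 5) + 30
    expand = solve-∀
    collect : ∀ n → 6 * (4 + n) + 30 ≡ 6 * n + 54
    collect = solve-∀
    factor : ∀ n → 10 * n + 55 ≡ 5 * (2 * (5 + n) + 1)
    factor = solve-∀

6*⌈n/4⌉≤2*n+1 : ∀ n → 4 ≤ n → n ≢ 5 → 6 * suc (pred n / 4) ≤ 2 * n + 1
6*⌈n/4⌉≤2*n+1 1 (s≤s ()) _
6*⌈n/4⌉≤2*n+1 2 (s≤s (s≤s ())) _
6*⌈n/4⌉≤2*n+1 3 (s≤s (s≤s (s≤s ()))) _
6*⌈n/4⌉≤2*n+1 4 _ _ = s≤s (s≤s (s≤s (s≤s (s≤s (s≤s z≤n)))))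
6*⌈n/4⌉≤2*n+1 5 _ n≢5 = ⊥-elim (n≢5 refl)
6*⌈n/4⌉≤2*n+1 6 _ _ = n≤1+n 12
6*⌈n/4⌉≤2*n+1 (suc (suc (suc (suc (suc (suc (suc n))))))) _ _ = *-cancelˡ-≤ 2 (begin
    2 * (6 * suc g)          ≡⟨ expand g ⟩
    3 * (g * 4) + 12         ≤⟨ +-monoˡ-≤ 12 (*-monoʳ-≤ 3 (m/n*n≤m (6 + n) 4)) ⟩
    3 * (6 + n) + 12         ≡⟨ collect n ⟩
    3 * n + 30               ≤⟨ +-monoˡ-≤ 30 (*-monoˡ-≤ n (n≤1+n 3)) ⟩
    4 * n + 30               ≡⟨ factor n ⟩
    2 * (2 * (7 + n) + 1)    ∎)
  where
    open ≤-Reasoning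
    g = (6 + n) / 4
    expand : ∀ g → 2 * (6 * suc g) ≡ 3 * (g * 4) + 12
    expand = solve-∀
    collect : ∀ n → 3 * (6 + n) + 12 ≡ 3 * n + 30
    collect = solve-∀
    factor : ∀ n → 4 * n + 30 ≡ 2 * (2 * (7 + n) + 1)
    factor = solve-∀

module FarMultipliers (k : ℕ) .{{_ : NonZero k}} (4≤k : 4 ≤ k) where
  open Arcs k 4≤k

  FarMultiplier : (n : ℕ) .{{_ : NonZero n}} → ℕ → ℕ → Set
  FarMultiplier n a b = ∃ λ t → Far n ⌈ n /k⌉ (t * a) × Far n ⌈ n /k⌉ (t * b)

  -- Modulo n = n₁ * g the multiples of n₁ * b are those of n₁ * gcd b g, which is at most
  -- n / 2 because gcd b g is a proper divisor of g.
  far-on-cofactor-multiples : ∀ n .{{_ : NonZero n}} a b n₁ → 1 ≤ a → n ≡ n₁ * gcd a n →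
    ¬ (gcd a n ∣ b) → ∀ x → ∃ λ j → Far n ⌈ n /k⌉ (x + j * (n₁ * b))
  far-on-cofactor-multiples n a b n₁ 1≤a n≡n₁g g∤b x =
    Walk.far-on-multiples n (q₀ n) x (n₁ * b) m 1≤m (2*m≤n⇒m+⌈n/k⌉+q₀≤n n m (>-nonZero⁻¹ n) 2m≤n) (w , wn₁b≡m)
    where
      g = gcd a n
      g≢0 : g ≢ 0
      g≢0 = gcd[m,n]≢0 a n (inj₁ (≢-nonZero⁻¹ a {{>-nonZero 1≤a}}))
      instance
        g≢0′ : NonZero g
        g≢0′ = ≢-nonZero g≢0
      h = gcd b g
      h<g : h < g
      h<g = ≤∧≢⇒< (∣⇒≤ (gcd[m,n]∣n b g)) (λ h≡g → g∤b (subst (_∣ b) h≡g (gcd[m,n]∣m b g)))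
      instance
        h≢0 : NonZero h
        h≢0 = ≢-nonZero (gcd[m,n]≢0 b g (inj₂ g≢0))
      r = g / h
      g≡rh : g ≡ r * h
      g≡rh = sym (m/n*n≡m (gcd[m,n]∣n b g))
      2≤r : 2 ≤ r
      2≤r = n≢0⇒n≢1⇒2≤n (λ r≡0 → g≢0 (trans g≡rh (cong (_* h) r≡0)))
              (λ r≡1 → <⇒≢ h<g (sym (trans g≡rh (trans (cong (_* h) r≡1) (*-identityˡ h)))))
      m = n₁ * h
      2m≤n : 2 * m ≤ n
      2m≤n = begin
        2 * (n₁ * h)   ≡⟨ swap n₁ h ⟩
        n₁ * (2 * h)   ≤⟨ *-monoʳ-≤ n₁ (*-monoˡ-≤ h 2≤r) ⟩
        n₁ * (r * h)   ≡⟨ cong (n₁ *_) (sym g≡rh) ⟩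
        n₁ * g         ≡⟨ sym n≡n₁g ⟩
        n              ∎
        where
          open ≤-Reasoning
          swap : ∀ x y → 2 * (x * y) ≡ x * (2 * y)
          swap = solve-∀
      instance
        n₁≢0 : NonZero n₁
        n₁≢0 = ≢-nonZero (λ n₁≡0 → ≢-nonZero⁻¹ n (trans n≡n₁g (cong (_* g) n₁≡0)))
        gn₁≢0 : NonZero (g * n₁)
        gn₁≢0 = m*n≢0 g n₁
      1≤m : 1 ≤ m
      1≤m = >-nonZero⁻¹ m {{m*n≢0 n₁ h}}
      w = proj₁ (gcd-multiplier g b)
      wn₁b≡m : (w * (n₁ * b)) % n ≡ m % n
      wn₁b≡m = begin
        (w * (n₁ * b)) % n         ≡⟨ %-congʳ (trans n≡n₁g (*-comm n₁ g)) ⟩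
        (w * (n₁ * b)) % (g * n₁)  ≡⟨ cong (_% (g * n₁)) (reassoc w n₁ b) ⟩
        (w * b * n₁) % (g * n₁)    ≡⟨ sym (m%n*o≡m*o%[n*o] (w * b) g n₁) ⟩
        ((w * b) % g) * n₁         ≡⟨ cong (_* n₁) (proj₂ (gcd-multiplier g b)) ⟩
        (h % g) * n₁               ≡⟨ cong (_* n₁) (m<n⇒m%n≡m h<g) ⟩
        h * n₁                     ≡⟨ *-comm h n₁ ⟩
        m                          ≡⟨ sym (m<n⇒m%n≡m (2*m≤n⇒m<n 1≤m 2m≤n)) ⟩
        m % n                      ∎
        where
          open ≡-Reasoning
          reassoc : ∀ w n₁ b → w * (n₁ * b) ≡ w * b * n₁
          reassoc = solve-∀

  -- First make t * a far using steps of gcd a n, then correct t by multiples of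
  -- n / gcd a n, which leave t * a unchanged modulo n.
  far-multiplier-∤ : ∀ n .{{_ : NonZero n}} a b → 1 ≤ a → 2 * a ≤ n → ¬ (gcd a n ∣ b) → FarMultiplier n a b
  far-multiplier-∤ n a b 1≤a 2a≤n g∤b = t , Far-cong n k₁a≡ta far-k₁a , subst (Far n ⌈ n /k⌉) (distrib k₁ j n₁ b) far-tb
    where
      g = gcd a n
      instance
        g≢0 : NonZero g
        g≢0 = ≢-nonZero (gcd[m,n]≢0 a n (inj₁ (≢-nonZero⁻¹ a {{>-nonZero 1≤a}})))
      2g≤n : 2 * g ≤ n
      2g≤n = ≤-trans (*-monoʳ-≤ 2 (∣⇒≤ {{>-nonZero 1≤a}} (gcd[m,n]∣m a n))) 2a≤n
      k₁-far = Walk.far-on-multiples n (q₀ n) 0 a g (>-nonZero⁻¹ g)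
                 (2*m≤n⇒m+⌈n/k⌉+q₀≤n n g (>-nonZero⁻¹ n) 2g≤n) (gcd-multiplier n a)
      k₁ = proj₁ k₁-far
      far-k₁a = proj₂ k₁-far
      n₁ = n / g
      a₁ = a / g
      n≡n₁g = sym (m/n*n≡m (gcd[m,n]∣n a n))
      j-far = far-on-cofactor-multiples n a b n₁ 1≤a n≡n₁g g∤b (k₁ * b)
      j = proj₁ j-far
      far-tb = proj₂ j-far
      t = k₁ + j * n₁
      distrib : ∀ k₁ j n₁ b → k₁ * b + j * (n₁ * b) ≡ (k₁ + j * n₁) * b
      distrib = solve-∀
      k₁a≡ta : (k₁ * a) % n ≡ (t * a) % n
      k₁a≡ta = begin
        (k₁ * a) % n                               ≡⟨ sym ([m+kn]%n≡m%n (k₁ * a) (j * a₁) n) ⟩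
        (k₁ * a + (j * a₁) * n) % n                ≡⟨ cong₂ (λ x y → (k₁ * x + (j * a₁) * y) % n) a≡a₁g n≡n₁g ⟩
        (k₁ * (a₁ * g) + (j * a₁) * (n₁ * g)) % n  ≡⟨ cong (_% n) (regroup k₁ j n₁ a₁ g) ⟩
        (t * (a₁ * g)) % n                         ≡⟨ cong (λ x → (t * x) % n) (sym a≡a₁g) ⟩
        (t * a) % n                                ∎
        where
          open ≡-Reasoning
          a≡a₁g = sym (m/n*n≡m (gcd[m,n]∣m a n))
          regroup : ∀ k₁ j n₁ a₁ g → k₁ * (a₁ * g) + (j * a₁) * (n₁ * g) ≡ (k₁ + j * n₁) * (a₁ * g)
          regroup = solve-∀

  far-multiplier-invertible : ∀ n .{{_ : NonZero n}} a b u → 1 ≤ a → 1 ≤ b → a ≢ b →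
    2 * a ≤ n → 2 * b ≤ n → (u * a) % n ≡ 1 % n → 6 * ⌈ n /k⌉ ≤ 2 * n + 1 → FarMultiplier n a b
  far-multiplier-invertible n a b u 1≤a 1≤b a≢b 2a≤n 2b≤n ua≡1 6q≤2n+1 =
    u * s , Far-cong n s≡usa far-s , subst (Far n ⌈ n /k⌉) (reassoc s u b) (c-represents s far-sc)
    where
      open ≡-Reasoning
      ratio = ratio-representative n (q₀ n) a b u 1≤a 1≤b a≢b 2a≤n 2b≤n ua≡1
      c = proj₁ ratio
      2≤c = proj₁ (proj₂ ratio)
      2c≤n = proj₁ (proj₂ (proj₂ ratio))
      c-represents = proj₂ (proj₂ (proj₂ ratio))
      s-far = Walk.far-with-multiple n (q₀ n) c 2≤c (2*m≤n⇒m+⌈n/k⌉+q₀≤n n c (>-nonZero⁻¹ n) 2c≤n) 6q≤2n+1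
      s = proj₁ s-far
      far-s = proj₁ (proj₂ s-far)
      far-sc = proj₂ (proj₂ s-far)
      reassoc : ∀ s u a → s * (u * a) ≡ u * s * a
      reassoc = solve-∀
      s≡usa : s % n ≡ (u * s * a) % n
      s≡usa = begin
        s % n              ≡⟨ cong (_% n) (sym (*-identityʳ s)) ⟩
        (s * 1) % n        ≡⟨ %-*-congʳ n s (sym ua≡1) ⟩
        (s * (u * a)) % n  ≡⟨ cong (_% n) (reassoc s u a) ⟩
        (u * s * a) % n    ∎

  FarMultiplier-*ʳ : ∀ {n n₁ d a a₁ b b₁} .{{_ : NonZero n}} .{{_ : NonZero n₁}} → 1 ≤ d →
    n ≡ n₁ * d → a ≡ a₁ * d → b ≡ b₁ * d → FarMultiplier n₁ a₁ b₁ → FarMultiplier n a b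
  FarMultiplier-*ʳ {n} {n₁} {d} {a₁ = a₁} {b₁ = b₁} 1≤d n≡n₁d refl refl (t , far-ta₁ , far-tb₁) =
    t , scale a₁ far-ta₁ , scale b₁ far-tb₁
    where
      ⌈n/k⌉≤d*⌈n₁/k⌉ : ⌈ n /k⌉ ≤ d * ⌈ n₁ /k⌉
      ⌈n/k⌉≤d*⌈n₁/k⌉ = subst (λ m → ⌈ m /k⌉ ≤ d * ⌈ n₁ /k⌉) (sym n≡n₁d)
                          (⌈m*d/k⌉≤d*⌈m/k⌉ n₁ d (>-nonZero⁻¹ n₁) 1≤d)
      scale : ∀ x → Far n₁ ⌈ n₁ /k⌉ (t * x) → Far n ⌈ n /k⌉ (t * (x * d))
      scale x far = subst (Far n ⌈ n /k⌉) (*-assoc t x d) (Far-*ʳ n≡n₁d ⌈n/k⌉≤d*⌈n₁/k⌉ (t * x) far)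

  -- The hypothesis of far-with-multiple, for every modulus the problem can be reduced to.
  SmallArcs : ℕ → Set
  SmallArcs n = ∀ n₁ → n₁ ∣ n → 4 ≤ n₁ → 6 * ⌈ n₁ /k⌉ ≤ 2 * n₁ + 1

  -- Dividing by g = gcd a n makes a invertible modulo n / g.
  far-multiplier-∣ : ∀ n .{{_ : NonZero n}} a b → 1 ≤ a → 1 ≤ b → a ≢ b → 2 * a ≤ n → 2 * b ≤ n →
    gcd a n ∣ b → SmallArcs n → FarMultiplier n a b
  far-multiplier-∣ n a b 1≤a 1≤b a≢b 2a≤n 2b≤n g∣b small =
    FarMultiplier-*ʳ (>-nonZero⁻¹ g) n≡n₁g a≡a₁g b≡b₁g
      (far-multiplier-invertible n₁ a₁ b₁ u 1≤a₁ 1≤b₁ a₁≢b₁ 2a₁≤n₁ 2b₁≤n₁ ua₁≡1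
        (small n₁ (divides g (trans n≡n₁g (*-comm n₁ g)))
               (distinct-halves⇒4≤n 1≤a₁ 1≤b₁ a₁≢b₁ 2a₁≤n₁ 2b₁≤n₁)))
    where
      g = gcd a n
      instance
        g≢0 : NonZero g
        g≢0 = ≢-nonZero (gcd[m,n]≢0 a n (inj₁ (≢-nonZero⁻¹ a {{>-nonZero 1≤a}})))
      n₁ = n / g
      a₁ = a / g
      b₁ = b / g
      n≡n₁g = sym (m/n*n≡m (gcd[m,n]∣n a n))
      a≡a₁g = sym (m/n*n≡m (gcd[m,n]∣m a n))
      b≡b₁g = sym (m/n*n≡m g∣b)
      instance
        n₁≢0 : NonZero n₁
        n₁≢0 = ≢-nonZero (λ n₁≡0 → ≢-nonZero⁻¹ n (trans n≡n₁g (cong (_* g) n₁≡0)))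
      reduce-pos : ∀ x {y} → y ≡ x * g → 1 ≤ y → 1 ≤ x
      reduce-pos zero y≡0 1≤y = ⊥-elim (<⇒≢ 1≤y (sym y≡0))
      reduce-pos (suc x) _ _ = s≤s z≤n
      reduce-half : ∀ x {y} → y ≡ x * g → 2 * y ≤ n → 2 * x ≤ n₁
      reduce-half x y≡xg 2y≤n =
        *-cancelʳ-≤ (2 * x) n₁ g (subst₂ _≤_ (trans (cong (2 *_) y≡xg) (sym (*-assoc 2 x g))) n≡n₁g 2y≤n)
      1≤a₁ = reduce-pos a₁ a≡a₁g 1≤a
      1≤b₁ = reduce-pos b₁ b≡b₁g 1≤b
      2a₁≤n₁ = reduce-half a₁ a≡a₁g 2a≤n
      2b₁≤n₁ = reduce-half b₁ b≡b₁g 2b≤n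
      a₁≢b₁ : a₁ ≢ b₁
      a₁≢b₁ a₁≡b₁ = a≢b (trans a≡a₁g (trans (cong (_* g) a₁≡b₁) (sym b≡b₁g)))
      GCD[a₁,n₁]≡1 : GCD a₁ n₁ 1
      GCD[a₁,n₁]≡1 = GCD-* (subst₂ (λ x y → GCD x y (1 * g)) a≡a₁g n≡n₁g
                              (subst (GCD a n) (sym (*-identityˡ g)) (gcd-GCD a n)))
      u = proj₁ (Bézout⇒multiplier n₁ a₁ (Bézout.identity GCD[a₁,n₁]≡1))
      ua₁≡1 = proj₂ (Bézout⇒multiplier n₁ a₁ (Bézout.identity GCD[a₁,n₁]≡1))

  far-multiplier : ∀ n .{{_ : NonZero n}} a b → 1 ≤ a → 1 ≤ b → a ≢ b → 2 * a ≤ n → 2 * b ≤ n →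
    SmallArcs n → FarMultiplier n a b
  far-multiplier n a b 1≤a 1≤b a≢b 2a≤n 2b≤n small with gcd a n ∣? b
  ... | yes g∣b = far-multiplier-∣ n a b 1≤a 1≤b a≢b 2a≤n 2b≤n g∣b small
  ... | no g∤b = far-multiplier-∤ n a b 1≤a 2a≤n g∤b

-- Vertex x gets the index of the arc containing t * x when ℤ_n is cut into k arcs of
-- length at most q; far residues jump over a whole arc.
module ArcColouring (n : ℕ) .{{_ : NonZero n}} (k q₀ : ℕ) .{{_ : NonZero k}}
                    (n≤q*k : n ≤ suc q₀ * k) (t : ℕ) where

  q : ℕ
  q = suc q₀

  arc : ℕ → ℕ
  arc x = (k * ((t * x) % n)) / n

  arc<k : ∀ x → arc x < k
  arc<k x = m<n*o⇒m/o<n (*-monoʳ-< k (m%n<n (t * x) n))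

  k*u/n<k*v/n : ∀ u v → u + q ≤ v → (k * u) / n < (k * v) / n
  k*u/n<k*v/n u v u+q≤v = begin-strict
    (k * u) / n                ≡⟨ cong (_/ n) (m+n∸n≡m (k * u) n) ⟨
    (k * u + n ∸ n) / n        <⟨ n<1+n _ ⟩
    1 + (k * u + n ∸ n) / n    ≡⟨ m/n≡1+[m∸n]/n (m≤n+m n (k * u)) ⟨
    (k * u + n) / n            ≤⟨ /-monoˡ-≤ n (+-monoʳ-≤ (k * u) n≤q*k) ⟩
    (k * u + q * k) / n        ≡⟨ cong (_/ n) (factor k u q) ⟩
    (k * (u + q)) / n          ≤⟨ /-monoˡ-≤ n (*-monoʳ-≤ k u+q≤v) ⟩
    (k * v) / n                ∎
    where
      open ≤-Reasoning
      factor : ∀ k u q → k * u + q * k ≡ k * (u + q)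
      factor = solve-∀

  arc-jumps : ∀ y z x → y < n → x ≡ (y + z) % n → q ≤ z → q + z ≤ n → (k * x) / n ≢ (k * y) / n
  arc-jumps y z x y<n x≡y+z q≤z q+z≤n with y + z <? n
  ... | yes y+z<n = λ eq → <⇒≢ (k*u/n<k*v/n y x y+q≤x) (sym eq)
    where
      y+q≤x : y + q ≤ x
      y+q≤x = subst (y + q ≤_) (sym (trans x≡y+z (m<n⇒m%n≡m y+z<n))) (+-monoʳ-≤ y q≤z)
  ... | no y+z≮n = <⇒≢ (k*u/n<k*v/n x y x+q≤y)
    where
      n≤y+z = ≮⇒≥ y+z≮n
      w = y + z ∸ n
      z<n : z < n
      z<n = ≤-trans (s≤s (m≤n+m z q₀)) q+z≤n
      x≡w : x ≡ w
      x≡w = trans x≡y+z (trans (sym (m≤n⇒[n∸m]%m≡n%m n≤y+z))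
                               (m<n⇒m%n≡m (<-trans (m+n∸o<n y z n y<n n≤y+z) z<n)))
      w+[n∸z]≡y : w + (n ∸ z) ≡ y
      w+[n∸z]≡y = +-cancelʳ-≡ z _ _ (begin
        w + (n ∸ z) + z   ≡⟨ +-assoc w (n ∸ z) z ⟩
        w + (n ∸ z + z)   ≡⟨ cong (w +_) (m∸n+n≡m (<⇒≤ z<n)) ⟩
        w + n             ≡⟨ m∸n+n≡m n≤y+z ⟩
        y + z             ∎)
        where open ≡-Reasoning
      x+q≤y : x + q ≤ y
      x+q≤y = subst (_≤ y) (cong (_+ q) (sym x≡w))
                (subst (w + q ≤_) w+[n∸z]≡y (+-monoʳ-≤ w (m+n≤o⇒m≤o∸n q q+z≤n)))

  arc-+-≢ : ∀ x e → Far n q (t * e) → arc (x + e) ≢ arc x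
  arc-+-≢ x e (q≤z , q+z≤n) = arc-jumps ((t * x) % n) ((t * e) % n) ((t * (x + e)) % n) (m%n<n _ n)
    (trans (cong (_% n) (*-distribˡ-+ t x e)) (%-distribˡ-+ (t * x) (t * e) n)) q≤z q+z≤n

  Far-cdist : (D : DistSet2 n) → Far n q (t * DistSet2.a D) → Far n q (t * DistSet2.b D) →
              ∀ i j → cdist n i j ∈D D → Far n q (t * ∣ toℕ i - toℕ j ∣)
  Far-cdist D far-a far-b i j dist∈D = from-min (⊓-sel e (n ∸ e))
    where
      e = ∣ toℕ i - toℕ j ∣
      far-D : ∀ {d} → d ∈D D → Far n q (t * d)
      far-D (inj₁ refl) = far-a
      far-D (inj₂ refl) = far-b
      far-dist : Far n q (t * (e ⊓ (n ∸ e)))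
      far-dist = far-D dist∈D
      e≤n : e ≤ n
      e≤n = ≤-trans (∣m-n∣≤m⊔n (toℕ i) (toℕ j)) (⊔-lub (<⇒≤ (toℕ<n i)) (<⇒≤ (toℕ<n j)))
      t[n∸e]+te≡0 : (t * (n ∸ e) + t * e) % n ≡ 0
      t[n∸e]+te≡0 = trans (cong (_% n) (trans (sym (*-distribˡ-+ t (n ∸ e) e)) (cong (t *_) (m∸n+n≡m e≤n))))
                          (m*n%n≡0 t n)
      from-min : (e ⊓ (n ∸ e) ≡ e) ⊎ (e ⊓ (n ∸ e) ≡ n ∸ e) → Far n q (t * e)
      from-min (inj₁ min≡e) = subst (λ d → Far n q (t * d)) min≡e far-dist
      from-min (inj₂ min≡n∸e) = Far-neg n (t * (n ∸ e)) (t * e) t[n∸e]+te≡0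
                                  (subst (λ d → Far n q (t * d)) min≡n∸e far-dist)

  arc-colorable : (D : DistSet2 n) → Far n q (t * DistSet2.a D) → Far n q (t * DistSet2.b D) →
                  Colorable n D k
  arc-colorable D far-a far-b = colour , proper
    where
      colour : Fin n → Fin k
      colour i = fromℕ< (arc<k (toℕ i))
      same-arc : ∀ i j → colour i ≡ colour j → arc (toℕ i) ≡ arc (toℕ j)
      same-arc i j eq = trans (sym (toℕ-fromℕ< (arc<k (toℕ i)))) (trans (cong toℕ eq) (toℕ-fromℕ< (arc<k (toℕ j))))
      distinct-arcs : ∀ i j → toℕ i ≤ toℕ j → Far n q (t * (toℕ j ∸ toℕ i)) → arc (toℕ i) ≢ arc (toℕ j)
      distinct-arcs i j i≤j far eq = arc-+-≢ (toℕ i) _ far (trans (cong arc (m+[n∸m]≡n i≤j)) (sym eq))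
      proper : ∀ i j → Adj n D i j → colour i ≢ colour j
      proper i j (_ , dist∈D) eq with ≤-total (toℕ i) (toℕ j)
      ... | inj₁ i≤j = distinct-arcs i j i≤j
          (subst (λ d → Far n q (t * d)) (m≤n⇒∣m-n∣≡n∸m i≤j) (Far-cdist D far-a far-b i j dist∈D)) (same-arc i j eq)
      ... | inj₂ j≤i = distinct-arcs j i j≤i
          (subst (λ d → Far n q (t * d)) (m≤n⇒∣n-m∣≡n∸m j≤i) (Far-cdist D far-a far-b i j dist∈D)) (same-arc j i (sym eq))

colorable-with-arcs : ∀ k .{{_ : NonZero k}} (4≤k : 4 ≤ k) n .{{_ : NonZero n}} →
  FarMultipliers.SmallArcs k 4≤k n → (D : DistSet2 n) → Colorable n D k
colorable-with-arcs k 4≤k n small D =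
  ArcColouring.arc-colorable n k (q₀ n) (n≤⌈n/k⌉*k n) t D far-ta far-tb
  where
    open Arcs k 4≤k
    open DistSet2 D
    multiplier = FarMultipliers.far-multiplier k 4≤k n a b 1≤a 1≤b a≢b
                   (m≤n/2⇒2*m≤n a n a≤n/2) (m≤n/2⇒2*m≤n b n b≤n/2) small
    t = proj₁ multiplier
    far-ta = proj₁ (proj₂ multiplier)
    far-tb = proj₂ (proj₂ multiplier)

five-colorable : ∀ n .{{_ : NonZero n}} (D : DistSet2 n) → Colorable n D 5
five-colorable n = colorable-with-arcs 5 (s≤s (s≤s (s≤s (s≤s z≤n)))) n
  (λ n₁ _ 4≤n₁ → 6*⌈n/5⌉≤2*n+1 n₁ 4≤n₁)

four-colorable : ∀ n .{{_ : NonZero n}} → ¬ 5 ∣ n → (D : DistSet2 n) → Colorable n D 4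
four-colorable n 5∤n = colorable-with-arcs 4 ≤-refl n
  (λ n₁ n₁∣n 4≤n₁ → 6*⌈n/4⌉≤2*n+1 n₁ 4≤n₁ (λ n₁≡5 → 5∤n (subst (_∣ n) n₁≡5 n₁∣n)))

module FiveClique (n m : ℕ) .{{_ : NonZero n}} (n≡5*m : n ≡ 5 * m) (1≤m : 1 ≤ m) where

  instance
    m≢0 : NonZero m
    m≢0 = >-nonZero 1≤m

  2*m≤n/2 : 2 * m ≤ n / 2
  2*m≤n/2 = 2*m≤n⇒m≤n/2 (2 * m) n
    (subst₂ _≤_ (regroup m) (sym n≡5*m) (*-monoˡ-≤ m {4} {5} (s≤s (s≤s (s≤s (s≤s z≤n))))))
    where
      regroup : ∀ m → 4 * m ≡ 2 * (2 * m)
      regroup = solve-∀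

  D : DistSet2 n
  D = dset (1 * m) (2 * m) m≢2*m (subst (1 ≤_) (sym (*-identityˡ m)) 1≤m) (≤-trans 1≤m (m≤m+n m (1 * m)))
           (≤-trans (*-monoˡ-≤ m {1} {2} (s≤s z≤n)) 2*m≤n/2) 2*m≤n/2
    where
      m≢2*m : 1 * m ≢ 2 * m
      m≢2*m = <⇒≢ (*-monoˡ-< m {1} {2} (s≤s (s≤s z≤n)))

  min[dm,[5∸d]m]∈D : ∀ d → 1 ≤ d → d ≤ 4 → ((d * m) ⊓ ((5 ∸ d) * m)) ∈D D
  min[dm,[5∸d]m]∈D 1 _ _ = inj₁ (m≤n⇒m⊓n≡m (*-monoˡ-≤ m {1} {4} (s≤s z≤n)))
  min[dm,[5∸d]m]∈D 2 _ _ = inj₂ (m≤n⇒m⊓n≡m (*-monoˡ-≤ m {2} {3} (s≤s (s≤s z≤n))))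
  min[dm,[5∸d]m]∈D 3 _ _ = inj₂ (m≥n⇒m⊓n≡n (*-monoˡ-≤ m {2} {3} (s≤s (s≤s z≤n))))
  min[dm,[5∸d]m]∈D 4 _ _ = inj₁ (m≥n⇒m⊓n≡n (*-monoˡ-≤ m {1} {4} (s≤s z≤n)))
  min[dm,[5∸d]m]∈D (suc (suc (suc (suc (suc d))))) _ (s≤s (s≤s (s≤s (s≤s ()))))

  vertex<n : (i : Fin 5) → toℕ i * m < n
  vertex<n i = subst (toℕ i * m <_) (sym n≡5*m) (*-monoˡ-< m (toℕ<n i))

  vertex : Fin 5 → Fin n
  vertex i = fromℕ< (vertex<n i)

  toℕ-vertex : ∀ i → toℕ (vertex i) ≡ toℕ i * m
  toℕ-vertex i = toℕ-fromℕ< (vertex<n i)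

  ¬colorable : ∀ c → c < 5 → ¬ Colorable n D c
  ¬colorable c c<5 (colour , proper) with pigeonhole c<5 (λ i → colour (vertex i))
  ... | i , j , i<j , same = proper (vertex i) (vertex j) (vi≢vj , dist∈D) same
    where
      open ≡-Reasoning
      d = toℕ j ∸ toℕ i
      vi≢vj : vertex i ≢ vertex j
      vi≢vj eq = <⇒≢ i<j (*-cancelʳ-≡ (toℕ i) (toℕ j) m
                   (trans (sym (toℕ-vertex i)) (trans (cong toℕ eq) (toℕ-vertex j))))
      ∣vi-vj∣≡dm : ∣ toℕ (vertex i) - toℕ (vertex j) ∣ ≡ d * m
      ∣vi-vj∣≡dm = begin
        ∣ toℕ (vertex i) - toℕ (vertex j) ∣  ≡⟨ cong₂ ∣_-_∣ (toℕ-vertex i) (toℕ-vertex j) ⟩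
        ∣ toℕ i * m - toℕ j * m ∣            ≡⟨ m≤n⇒∣m-n∣≡n∸m (*-monoˡ-≤ m (<⇒≤ i<j)) ⟩
        toℕ j * m ∸ toℕ i * m                ≡⟨ *-distribʳ-∸ m (toℕ j) (toℕ i) ⟨
        d * m                                ∎
      n∸dm≡[5∸d]m : n ∸ d * m ≡ (5 ∸ d) * m
      n∸dm≡[5∸d]m = trans (cong (_∸ d * m) n≡5*m) (sym (*-distribʳ-∸ m 5 d))
      dist∈D : cdist n (vertex i) (vertex j) ∈D D
      dist∈D = subst (_∈D D) (sym (cong₂ _⊓_ ∣vi-vj∣≡dm (trans (cong (n ∸_) ∣vi-vj∣≡dm) n∸dm≡[5∸d]m)))
                 (min[dm,[5∸d]m]∈D d (m<n⇒0<n∸m i<j) (≤-trans (m∸n≤m (toℕ j) (toℕ i)) (≤-pred (toℕ<n j))))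

corollary3p3p1 : (n : ℕ) → 4 ≤ n → (IsB2 n 5 ⇔ 5 ∣ n)
corollary3p3p1 n 4≤n = mk⇔ to from
  where
    instance
      n≢0 : NonZero n
      n≢0 = >-nonZero (≤-trans (s≤s z≤n) 4≤n)
    χ≤5 : ∀ D c → IsChromaticNumber n D c → c ≤ 5
    χ≤5 D c (_ , minimal) = ≮⇒≥ (λ 5<c → minimal 5 5<c (five-colorable n D))
    to : IsB2 n 5 → 5 ∣ n
    to ((D , _ , minimal) , _) = decidable-stable (5 ∣? n) (λ 5∤n → minimal 4 ≤-refl (four-colorable n 5∤n D))
    from : 5 ∣ n → IsB2 n 5
    from (divides m n≡m*5) = (D , (five-colorable n D , ¬colorable)) , χ≤5
      where
        n≡5*m = trans n≡m*5 (*-comm m 5)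
        1≤m : 1 ≤ m
        1≤m = n≢0⇒n>0 (λ m≡0 → ≢-nonZero⁻¹ n (trans n≡5*m (cong (5 *_) m≡0)))
        open FiveClique n m n≡5*m 1≤m
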